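{- Let $q=p^m$ with $p$ an odd prime and $m\in\mathbb{N}$, and let $k\in\mathbb{N}$ with $k\mid q-1$. If $\Gamma(k,q)$ is directed, then it has period $1$, with the only exception of $\Gamma(q-1,q)$, which has period $p$.
   Context: $R_k=\{x^k:x\in\mathbb{F}_q^*\}$; the generalized Paley graph $\Gamma(k,q)$ has vertex set $\mathbb{F}_q$ and an arc $x\to y$ iff $y-x\in R_k$; it is directed iff $R_k\neq-R_k$. The period of a digraph is the greatest common divisor of the lengths of all its directed cycles. -}

module Defs where

open import Level using (0ℓ)
open import Data.Nat using (ℕ; zero; suc)
open import Data.Nat.Divisibility using (_∣_)
open import Data.Fin using (Fin; zero; suc; inject₁; fromℕ)
open import Data.Product using (Σ; ∃; _×_)
open import Relation.Nullary using (¬_)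
open import Relation.Binary.PropositionalEquality using (_≡_)
open import Function.Definitions using (Injective)
import Algebra.Structures as S

-- A finite field of order q, realised on the carrier Fin q with
-- propositional equality: a commutative ring with 0 ≠ 1 in which every
-- nonzero element has a multiplicative inverse.
record FiniteField (q : ℕ) : Set where
  field
    _+_ _*_ : Fin q → Fin q → Fin q
    -_ : Fin q → Fin q
    0# 1# : Fin q
    isCommutativeRing : S.IsCommutativeRing {A = Fin q} _≡_ _+_ _*_ -_ 0# 1#
    0≢1 : ¬ (0# ≡ 1#)
    inverse : ∀ x → ¬ (x ≡ 0#) → ∃ λ y → x * y ≡ 1#

  infixr 8 _^_
  _^_ : Fin q → ℕ → Fin q
  x ^ zero = 1#
  x ^ suc n = x * (x ^ n)

  _-_ : Fin q → Fin q → Fin q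
  x - y = x + (- y)

  InR : ℕ → Fin q → Set
  InR k r = ∃ λ x → ¬ (x ≡ 0#) × (x ^ k ≡ r)

module Paley {q : ℕ} (F : FiniteField q) (k : ℕ) where
  open FiniteField F

  Arc : Fin q → Fin q → Set
  Arc x y = InR k (y - x)

  -- Γ(k,q) is directed iff R_k ≠ -R_k (as subsets of F_q).
  Directed : Set
  Directed = ¬ (∀ r → (InR k r → InR k (- r)) × (InR k (- r) → InR k r))

  -- A directed cycle of length (suc n): pairwise distinct vertices
  -- v 0, …, v n with arcs v i → v (i+1) and v n → v 0.
  record Cycle (n : ℕ) : Set where
    field
      v : Fin (suc n) → Fin q
      distinct : Injective _≡_ _≡_ v
      step : ∀ (i : Fin n) → Arc (v (inject₁ i)) (v (suc i))
      close : Arc (v (fromℕ n)) (v zero)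

  -- The period d is the gcd of the lengths of all directed cycles,
  -- characterised by the defining universal property of the gcd.
  HasPeriod : ℕ → Set
  HasPeriod d =
    (∀ n → Cycle n → d ∣ suc n) ×
    (∀ e → (∀ n → Cycle n → e ∣ suc n) → e ∣ d)

module Submission where

-- Since 1 ∈ R_k, the translation x ↦ x + 1 closes up after p steps, giving the cycle
-- 0 → 1 → ⋯ → p − 1 → 0 of length p in every Γ(k,q). For k = q − 1 Fermat's little
-- theorem gives R_k = {1}, so every arc is a translation by 1 and a cycle of length n
-- forces n·1 = 0, i.e. p ∣ n. For a proper divisor k of q − 1 the polynomial X^k − 1 has
-- at most k < q − 1 roots, so h = x^k ≠ 1 for some unit x.

open import Level using (0ℓ)
open import Function using (_∘_; id)
open import Data.Empty using (⊥; ⊥-elim)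
open import Data.Product using (∃; _×_; _,_; proj₁; proj₂)
open import Data.Sum using (inj₁; inj₂; [_,_]′)
open import Data.Nat as ℕ using (ℕ; zero; suc; _≤_; _<_; _∸_; ≢-nonZero)
open import Data.Nat.Properties
  using (≤-total; <⇒≱; ≤-<-trans; m≤n+m; m≤n⇒∃[o]m+o≡n; n<1⇒n≡0; suc-pred; ≤∧≢⇒<
        ; anyUpTo?)
import Data.Nat.Properties as ℕₚ
open import Data.Nat.Induction using (<-rec)
open import Data.Nat.DivMod using (_%_; _/_; m%n<n; m≡m%n+[m/n]*n)
open import Data.Nat.Divisibility
  using (_∣_; _∣?_; divides; 1∣_; ∣-reflexive; ∣-trans; ∣⇒≤; 0∣⇒≡0; m%n≡0⇒n∣m)
open import Data.Nat.GCD using (module Bézout)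
open import Data.Nat.Coprimality using (Coprime; coprime-Bézout)
open import Data.Nat.Primality using (Prime; prime⇒irreducible; prime⇒nonZero)
open import Data.Fin as Fin using (Fin; toℕ; punchIn)
import Data.Fin.Properties as Fin
open import Data.Fin.Induction using (<-weakInduction)
import Data.Fin.Permutation as Perm
open Perm using (_⟨$⟩ʳ_)
open import Data.Vec using (Vec; []; _∷_)
open import Relation.Nullary using (¬_; yes; no; contradiction)
open import Relation.Unary using (Pred; Decidable)
open import Relation.Binary.PropositionalEquality
open import Algebra.Bundles using (CommutativeRing)
import Algebra.Properties.CommutativeMonoid.Sum
import Algebra.Properties.Semiring.Mult
open import Defs

minimal-witness : ∀ {P : Pred ℕ 0ℓ} → Decidable P → ∀ {n} → P n →
                  ∃ λ m → P m × (∀ {j} → j < m → ¬ P j)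
minimal-witness {P} P? {n} = <-rec Goal search n
  where
  Goal : ℕ → Set
  Goal n = P n → ∃ λ m → P m × (∀ {j} → j < m → ¬ P j)
  search : ∀ n → (∀ {j} → j < n → Goal j) → Goal n
  search n below pn with anyUpTo? P? n
  ... | yes (j , j<n , pj) = below j<n pj
  ... | no  none           = n , pn , λ {j} j<n pj → none (j , j<n , pj)

injective-below : ∀ {A : Set} {n} (f : ℕ → A) →
                  (∀ {a c} → c < n → f a ≡ f (a ℕ.+ c) → c ≡ 0) →
                  ∀ {a b} → a < n → b < n → f a ≡ f b → a ≡ b
injective-below {n = n} f shift {a} {b} a<n b<n fa≡fb =
  [ (λ a≤b → ordered a≤b b<n fa≡fb)
  , (λ b≤a → sym (ordered b≤a a<n (sym fa≡fb)))
  ]′ (≤-total a b)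
  where
  ordered : ∀ {a b} → a ≤ b → b < n → f a ≡ f b → a ≡ b
  ordered {a} a≤b b<n fa≡fb with m≤n⇒∃[o]m+o≡n a≤b
  ... | c , refl rewrite shift (≤-<-trans (m≤n+m c a) b<n) fa≡fb = sym (ℕₚ.+-identityʳ a)

∣∧<⇒≡0 : ∀ {m n} → m ∣ n → n < m → n ≡ 0
∣∧<⇒≡0 {n = zero}  _   _   = refl
∣∧<⇒≡0 {n = suc n} m∣n n<m = contradiction (∣⇒≤ m∣n) (<⇒≱ n<m)

prime∤⇒coprime : ∀ {p n} → Prime p → ¬ p ∣ n → Coprime p n
prime∤⇒coprime p-prime p∤n (i∣p , i∣n) with prime⇒irreducible p-prime i∣p
... | inj₁ i≡1 = i≡1
... | inj₂ refl = contradiction i∣n p∤n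

-- Throughout, q = suc N.
module _ {N : ℕ} (F : FiniteField (suc N)) where

  commutativeRing : CommutativeRing 0ℓ 0ℓ
  commutativeRing = record { isCommutativeRing = FiniteField.isCommutativeRing F }

  open CommutativeRing commutativeRing
    using ( Carrier; _+_; _*_; -_; _-_; 0#; 1#; +-assoc; +-comm; +-identityˡ; +-identityʳ
          ; -‿inverseˡ; *-assoc; *-comm; *-identityˡ; *-identityʳ; distribˡ; distribʳ
          ; zeroˡ; zeroʳ
          ; ring; semiring; commutativeSemiring; +-commutativeMonoid; *-commutativeMonoid )
  open import Algebra.Properties.Ring ring
    using ( +-identityˡ-unique; +-identityʳ-unique; //-rightDividesˡ; //-rightDividesʳ
          ; x∙y⁻¹≈ε⇒x≈y; -‿involutive; -0#≈0# )
  open import Algebra.Properties.CommutativeSemiring.Exp commutativeSemiring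
    using (_^_; ^-homo-*; ^-assocʳ)
  module Mult = Algebra.Properties.Semiring.Mult semiring
  module Σ = Algebra.Properties.CommutativeMonoid.Sum +-commutativeMonoid
  module Π = Algebra.Properties.CommutativeMonoid.Sum *-commutativeMonoid
  open FiniteField F using (InR; 0≢1; inverse) renaming (_^_ to _^ᶠ_)
  open ≡-Reasoning

  -- Arithmetic of a finite field

  1≢0 : 1# ≢ 0#
  1≢0 = 0≢1 ∘ sym

  q-1≢0 : N ≢ 0
  q-1≢0 N≡0 = 0≢1 (Fin.toℕ-injective (trans (toℕ≡0 0#) (sym (toℕ≡0 1#))))
    where
    toℕ≡0 : ∀ (i : Fin (suc N)) → toℕ i ≡ 0
    toℕ≡0 i = n<1⇒n≡0 (subst (toℕ i <_) (cong suc N≡0) (Fin.toℕ<n i))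

  x*y≡1⇒x*[y*z]≡z : ∀ {x y} → x * y ≡ 1# → ∀ z → x * (y * z) ≡ z
  x*y≡1⇒x*[y*z]≡z {x} {y} xy≡1 z = begin
    x * (y * z)  ≡⟨ *-assoc x y z ⟨
    x * y * z    ≡⟨ cong (_* z) xy≡1 ⟩
    1# * z       ≡⟨ *-identityˡ z ⟩
    z            ∎

  *-cancelˡ-≢0 : ∀ {a x y} → a ≢ 0# → a * x ≡ a * y → x ≡ y
  *-cancelˡ-≢0 {a} {x} {y} a≢0 ax≡ay = begin
    x             ≡⟨ x*y≡1⇒x*[y*z]≡z b*a≡1 x ⟨
    b * (a * x)   ≡⟨ cong (b *_) ax≡ay ⟩
    b * (a * y)   ≡⟨ x*y≡1⇒x*[y*z]≡z b*a≡1 y ⟩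
    y             ∎
    where
    b : Carrier
    b = proj₁ (inverse a a≢0)
    b*a≡1 : b * a ≡ 1#
    b*a≡1 = trans (*-comm b a) (proj₂ (inverse a a≢0))

  *-≢0 : ∀ {x y} → x ≢ 0# → y ≢ 0# → x * y ≢ 0#
  *-≢0 {x} x≢0 y≢0 xy≡0 = y≢0 (*-cancelˡ-≢0 x≢0 (trans xy≡0 (sym (zeroʳ x))))

  ^-≢0 : ∀ {x} n → x ≢ 0# → x ^ n ≢ 0#
  ^-≢0 zero    x≢0 = 1≢0
  ^-≢0 (suc n) x≢0 = *-≢0 x≢0 (^-≢0 n x≢0)

  ^ᶠ≗^ : ∀ x n → x ^ᶠ n ≡ x ^ n
  ^ᶠ≗^ x zero    = refl
  ^ᶠ≗^ x (suc n) = cong (x *_) (^ᶠ≗^ x n)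

  -- (1 ^ 0) ^ n ≡ 1 ^ (0 * n) computes to 1 ^ n ≡ 1.
  1^n≡1 : ∀ n → 1# ^ n ≡ 1#
  1^n≡1 = ^-assocʳ 1# 0

  ι : ℕ → Carrier
  ι n = n Mult.× 1#

  ι-homo-+ : ∀ m n → ι (m ℕ.+ n) ≡ ι m + ι n
  ι-homo-+ = Mult.×-homo-+ 1#

  ι-homo-* : ∀ m n → ι (m ℕ.* n) ≡ ι m * ι n
  ι-homo-* = Mult.×1-homo-*

  ι-*-≡0 : ∀ c {m} → ι m ≡ 0# → ι (c ℕ.* m) ≡ 0#
  ι-*-≡0 c {m} ι[m]≡0 = trans (ι-homo-* c m) (trans (cong (ι c *_) ι[m]≡0) (zeroʳ (ι c)))

  ι-zeros-not-adjacent : ∀ {a b} → ι a ≡ 0# → ι b ≡ 0# → suc a ≢ b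
  ι-zeros-not-adjacent {a} ι[a]≡0 ι[b]≡0 refl = 1≢0 (begin
    1#          ≡⟨ +-identityʳ 1# ⟨
    1# + 0#     ≡⟨ cong (1# +_) ι[a]≡0 ⟨
    ι (suc a)   ≡⟨ ι[b]≡0 ⟩
    0#          ∎)

  -- The sum of all elements is invariant under the translation x ↦ x + 1.
  ι[q]≡0 : ι (suc N) ≡ 0#
  ι[q]≡0 = +-identityʳ-unique total (ι (suc N)) (sym (begin
    total                              ≡⟨ Σ.sum-permute id shift ⟩
    Σ.sum (λ x → x + 1#)               ≡⟨ Σ.∑-distrib-+ {suc N} id (λ _ → 1#) ⟩
    total + Σ.sum {suc N} (λ _ → 1#)   ≡⟨ cong (total +_) (Σ.sum-replicate (suc N)) ⟩
    total + ι (suc N)                  ∎))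
    where
    total : Carrier
    total = Σ.sum id
    shift : Perm.Permutation′ (suc N)
    shift = Perm.permutation (_+ 1#) (_- 1#) (//-rightDividesˡ 1#) (//-rightDividesʳ 1#)

  ι[p^m]≡0⇒ι[p]≡0 : ∀ p m → ι (p ℕ.^ m) ≡ 0# → ι p ≡ 0#
  ι[p^m]≡0⇒ι[p]≡0 p zero    ι[1]≡0 = ⊥-elim (ι-zeros-not-adjacent {0} refl ι[1]≡0 refl)
  ι[p^m]≡0⇒ι[p]≡0 p (suc m) ι[p^m+1]≡0 with ι p Fin.≟ 0#
  ... | yes ι[p]≡0 = ι[p]≡0
  ... | no  ι[p]≢0 = ι[p^m]≡0⇒ι[p]≡0 p m (*-cancelˡ-≢0 ι[p]≢0 (begin
    ι p * ι (p ℕ.^ m)  ≡⟨ ι-homo-* p (p ℕ.^ m) ⟨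
    ι (p ℕ.^ suc m)    ≡⟨ ι[p^m+1]≡0 ⟩
    0#                 ≡⟨ zeroʳ (ι p) ⟨
    ι p * 0#           ∎))

  unit : Fin N → Carrier
  unit = punchIn 0#

  unit-≢0 : ∀ i → unit i ≢ 0#
  unit-≢0 = Fin.punchInᵢ≢i 0#

  unit-injective : ∀ {i j} → unit i ≡ unit j → i ≡ j
  unit-injective = Fin.punchIn-injective 0# _ _

  Π-*-scale : ∀ {n} a (f : Fin n → Carrier) → Π.sum (λ i → a * f i) ≡ a ^ n * Π.sum f
  Π-*-scale {n} a f = trans (Π.∑-distrib-+ (λ _ → a) f) (cong (_* Π.sum f) (Π.sum-replicate n))

  Π-≢0 : ∀ {n} (f : Fin n → Carrier) → (∀ i → f i ≢ 0#) → Π.sum f ≢ 0#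
  Π-≢0 {zero}  f f≢0 = 1≢0
  Π-≢0 {suc n} f f≢0 = *-≢0 (f≢0 Fin.zero) (Π-≢0 (f ∘ Fin.suc) (f≢0 ∘ Fin.suc))

  -- Multiplication by a fixes 0#, so it permutes the units; compare their products.
  fermat : ∀ {a} → a ≢ 0# → a ^ N ≡ 1#
  fermat {a} a≢0 = *-cancelˡ-≢0 (Π-≢0 unit unit-≢0) (begin
    U * a ^ N                    ≡⟨ *-comm U (a ^ N) ⟩
    a ^ N * U                    ≡⟨ Π-*-scale a unit ⟨
    Π.sum (λ i → a * unit i)     ≡⟨ Π.sum-cong-≗ a*unit ⟩
    Π.sum (unit ∘ (π⁰ ⟨$⟩ʳ_))    ≡⟨ Π.sum-permute unit π⁰ ⟨
    U                            ≡⟨ *-identityʳ U ⟨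
    U * 1#                       ∎)
    where
    U b : Carrier
    U = Π.sum unit
    b = proj₁ (inverse a a≢0)
    a*b≡1 : a * b ≡ 1#
    a*b≡1 = proj₂ (inverse a a≢0)
    π : Perm.Permutation′ (suc N)
    π = Perm.permutation (a *_) (b *_) (x*y≡1⇒x*[y*z]≡z a*b≡1)
                                       (x*y≡1⇒x*[y*z]≡z (trans (*-comm b a) a*b≡1))
    π⁰ : Perm.Permutation′ N
    π⁰ = Perm.remove 0# π
    a*unit : ∀ i → a * unit i ≡ unit (π⁰ ⟨$⟩ʳ i)
    a*unit i = begin
      π ⟨$⟩ʳ unit i                ≡⟨ Perm.punchIn-permute π 0# i ⟩
      punchIn (a * 0#) (π⁰ ⟨$⟩ʳ i)  ≡⟨ cong (λ z → punchIn z (π⁰ ⟨$⟩ʳ i)) (zeroʳ a) ⟩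
      unit (π⁰ ⟨$⟩ʳ i)             ∎

  -- Polynomials

  eval : ∀ {n} → Vec Carrier n → Carrier → Carrier
  eval []       t = 0#
  eval (c ∷ cs) t = c + t * eval cs t

  quotient : ∀ {n} → Vec Carrier (suc n) → Carrier → Vec Carrier n
  quotient (c ∷ [])         a = []
  quotient (c ∷ cs@(_ ∷ _)) a = eval cs a ∷ quotient cs a

  -- Phrased without subtraction so that the semiring solver proves the inductive step.
  eval-quotient : ∀ {n} (P : Vec Carrier (suc n)) a u →
                  eval P (a + u) ≡ eval P a + u * eval (quotient P a) (a + u)
  eval-quotient (c ∷ []) a u = begin
    c + (a + u) * 0#       ≡⟨ cong (c +_) (zeroʳ (a + u)) ⟩
    c + 0#                 ≡⟨ +-identityʳ (c + 0#) ⟨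
    c + 0# + 0#            ≡⟨ cong₂ (λ x y → c + x + y) (zeroʳ a) (zeroʳ u) ⟨
    c + a * 0# + u * 0#    ∎
  eval-quotient (c ∷ cs@(_ ∷ _)) a u = begin
    c + (a + u) * eval cs (a + u)      ≡⟨ cong (λ z → c + (a + u) * z) (eval-quotient cs a u) ⟩
    c + (a + u) * (s + u * w)          ≡⟨ expand a u c s w ⟩
    c + a * s + u * (s + (a + u) * w)  ∎
    where
    s w : Carrier
    s = eval cs a
    w = eval (quotient cs a) (a + u)
    open import Algebra.Solver.Ring.NaturalCoefficients.Default commutativeSemiring
    expand : ∀ a u c s w → c + (a + u) * (s + u * w) ≡ c + a * s + u * (s + (a + u) * w)
    expand = solve 5 (λ a u c s w → c :+ (a :+ u) :* (s :+ u :* w)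
                                  := c :+ a :* s :+ u :* (s :+ (a :+ u) :* w)) refl

  vanishes-everywhere : ∀ {n} (P : Vec Carrier n) (r : Fin n → Carrier) →
                        (∀ {i j} → r i ≡ r j → i ≡ j) → (∀ i → eval P (r i) ≡ 0#) →
                        ∀ t → eval P t ≡ 0#
  vanishes-everywhere []        r r-injective roots t = refl
  vanishes-everywhere P@(_ ∷ _) r r-injective roots t = begin
    eval P t                       ≡⟨ factor t ⟩
    eval P a + (t - a) * eval Q t  ≡⟨ cong₂ (λ x y → x + (t - a) * y) (roots Fin.zero) (Q≡0 t) ⟩
    0# + (t - a) * 0#              ≡⟨ trans (+-identityˡ _) (zeroʳ (t - a)) ⟩
    0#                             ∎
    where
    a : Carrier
    a = r Fin.zero
    Q : Vec Carrier _
    Q = quotient P a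
    factor : ∀ t → eval P t ≡ eval P a + (t - a) * eval Q t
    factor t = subst (λ z → eval P z ≡ eval P a + (t - a) * eval Q z)
                     (trans (+-comm a (t - a)) (//-rightDividesˡ a t)) (eval-quotient P a (t - a))
    Q-roots : ∀ i → eval Q (r (Fin.suc i)) ≡ 0#
    Q-roots i = *-cancelˡ-≢0 rᵢ-a≢0 (begin
      (rᵢ - a) * eval Q rᵢ             ≡⟨ +-identityˡ _ ⟨
      0# + (rᵢ - a) * eval Q rᵢ        ≡⟨ cong (_+ (rᵢ - a) * eval Q rᵢ) (roots Fin.zero) ⟨
      eval P a + (rᵢ - a) * eval Q rᵢ  ≡⟨ factor rᵢ ⟨
      eval P rᵢ                        ≡⟨ roots (Fin.suc i) ⟩
      0#                               ≡⟨ zeroʳ (rᵢ - a) ⟨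
      (rᵢ - a) * 0#                    ∎)
      where
      rᵢ : Carrier
      rᵢ = r (Fin.suc i)
      rᵢ-a≢0 : rᵢ - a ≢ 0#
      rᵢ-a≢0 rᵢ-a≡0 with () ← r-injective (x∙y⁻¹≈ε⇒x≈y rᵢ a rᵢ-a≡0)
    Q≡0 : ∀ t → eval Q t ≡ 0#
    Q≡0 = vanishes-everywhere Q (r ∘ Fin.suc) (Fin.suc-injective ∘ r-injective) Q-roots

  monomial : ∀ k → Vec Carrier (suc k)
  monomial zero    = 1# ∷ []
  monomial (suc k) = 0# ∷ monomial k

  eval-monomial : ∀ k t → eval (monomial k) t ≡ t ^ k
  eval-monomial zero    t = trans (cong (1# +_) (zeroʳ t)) (+-identityʳ 1#)
  eval-monomial (suc k) t = trans (+-identityˡ _) (cong (t *_) (eval-monomial k t))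

  not-all-roots-of-unity : ∀ k → suc k < N → ¬ (∀ i → unit i ^ suc k ≡ 1#)
  not-all-roots-of-unity k k+1<N all-roots = 1≢0 (begin
    1#          ≡⟨ -‿involutive 1# ⟨
    - (- 1#)    ≡⟨ cong -_ -1≡0 ⟩
    - 0#        ≡⟨ -0#≈0# ⟩
    0#          ∎)
    where
    P : Vec Carrier (2 ℕ.+ k)
    P = - 1# ∷ monomial k
    r : Fin (2 ℕ.+ k) → Carrier
    r j = unit (Fin.inject≤ j k+1<N)
    r-injective : ∀ {i j} → r i ≡ r j → i ≡ j
    r-injective = Fin.inject≤-injective k+1<N k+1<N _ _ ∘ unit-injective
    roots : ∀ j → eval P (r j) ≡ 0#
    roots j = begin
      eval P (r j)        ≡⟨ cong (λ z → - 1# + r j * z) (eval-monomial k (r j)) ⟩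
      - 1# + r j ^ suc k  ≡⟨ cong (- 1# +_) (all-roots _) ⟩
      - 1# + 1#           ≡⟨ -‿inverseˡ 1# ⟩
      0#                  ∎
    -1≡0 : - 1# ≡ 0#
    -1≡0 = begin
      - 1#          ≡⟨ +-identityʳ (- 1#) ⟨
      - 1# + 0#     ≡⟨ cong (- 1# +_) (zeroˡ (eval (monomial k) 0#)) ⟨
      eval P 0#     ≡⟨ vanishes-everywhere P r r-injective roots 0# ⟩
      0#            ∎

  non-root-of-unity : ∀ k → suc k < N → ∃ λ x → x ≢ 0# × x ^ suc k ≢ 1#
  non-root-of-unity k k+1<N
    with Fin.¬∀⟶∃¬ N _ (λ i → unit i ^ suc k Fin.≟ 1#) (not-all-roots-of-unity k k+1<N)
  ... | i , uᵢ^[k+1]≢1 = unit i , unit-≢0 i , uᵢ^[k+1]≢1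

  -- Cycles of generalized Paley graphs

  module Cycles (k : ℕ) where
    open Paley F k

    arc : ∀ {x r} → InR k r → Arc x (r + x)
    arc {x} {r} = subst (InR k) (sym (//-rightDividesʳ x r))

    1∈R : InR k 1#
    1∈R = 1# , 1≢0 , trans (^ᶠ≗^ 1# k) (1^n≡1 k)

    kth-power-∈R : ∀ {x} → x ≢ 0# → ∀ t → InR k ((x ^ k) ^ t)
    kth-power-∈R {x} x≢0 t = x ^ t , ^-≢0 t x≢0 , (begin
      (x ^ t) ^ᶠ k    ≡⟨ ^ᶠ≗^ (x ^ t) k ⟩
      (x ^ t) ^ k     ≡⟨ ^-assocʳ x t k ⟩
      x ^ (t ℕ.* k)   ≡⟨ cong (x ^_) (ℕₚ.*-comm t k) ⟩
      x ^ (k ℕ.* t)   ≡⟨ ^-assocʳ x k t ⟨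
      (x ^ k) ^ t     ∎)

    cycle-of-walk : ∀ n (f : ℕ → Carrier) → (∀ t → Arc (f t) (f (suc t))) → f (suc n) ≡ f 0 →
                    (∀ {a b} → a < suc n → b < suc n → f a ≡ f b → a ≡ b) → Cycle n
    cycle-of-walk n f steps closed injective = record
      { v        = f ∘ toℕ
      ; distinct = Fin.toℕ-injective ∘ injective (Fin.toℕ<n _) (Fin.toℕ<n _)
      ; step     = λ i → subst (λ j → Arc (f j) (f (suc (toℕ i))))
                               (sym (Fin.toℕ-inject₁ i)) (steps (toℕ i))
      ; close    = subst₂ Arc (cong f (sym (Fin.toℕ-fromℕ n))) closed (steps n)
      }

    hasPeriod-of-cycle : ∀ {n} → Cycle n → (∀ m → Cycle m → suc n ∣ suc m) → HasPeriod (suc n)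
    hasPeriod-of-cycle {n} c divides-all = divides-all , λ e e∣all → e∣all n c

    coprime-cycles⇒hasPeriod-1 : ∀ {m n} → Cycle m → Cycle n → Coprime (suc m) (suc n) → HasPeriod 1
    coprime-cycles⇒hasPeriod-1 {m} {n} c c′ coprime =
      (λ _ _ → 1∣ _) , λ e e∣all → ∣-reflexive (coprime (e∣all m c , e∣all n c′))

  module TranslationGraph where
    open Paley F N

    arc⇒suc : ∀ {x y} → Arc x y → y ≡ 1# + x
    arc⇒suc {x} {y} (z , z≢0 , z^N≡y-x) = begin
      y          ≡⟨ //-rightDividesˡ x y ⟨
      y - x + x  ≡⟨ cong (_+ x) (trans (sym z^N≡y-x) (trans (^ᶠ≗^ z N) (fermat z≢0))) ⟩
      1# + x     ∎

    cycle-length-ι≡0 : ∀ {n} → Cycle n → ι (suc n) ≡ 0#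
    cycle-length-ι≡0 {n} c = +-identityˡ-unique (ι (suc n)) v₀ (sym (begin
      v₀                                      ≡⟨ arc⇒suc close ⟩
      1# + v (Fin.fromℕ n)                    ≡⟨ cong (1# +_) (vertex (Fin.fromℕ n)) ⟩
      1# + (ι (toℕ (Fin.fromℕ n)) + v₀)       ≡⟨ cong (λ j → 1# + (ι j + v₀)) (Fin.toℕ-fromℕ n) ⟩
      1# + (ι n + v₀)                         ≡⟨ +-assoc 1# (ι n) v₀ ⟨
      ι (suc n) + v₀                          ∎))
      where
      open Cycle c
      v₀ : Carrier
      v₀ = v Fin.zero
      vertex : ∀ i → v i ≡ ι (toℕ i) + v₀
      vertex = <-weakInduction (λ i → v i ≡ ι (toℕ i) + v₀) (sym (+-identityˡ v₀)) λ i vᵢ → begin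
        v (Fin.suc i)                         ≡⟨ arc⇒suc (step i) ⟩
        1# + v (Fin.inject₁ i)                ≡⟨ cong (1# +_) vᵢ ⟩
        1# + (ι (toℕ (Fin.inject₁ i)) + v₀)   ≡⟨ cong (λ j → 1# + (ι j + v₀)) (Fin.toℕ-inject₁ i) ⟩
        1# + (ι (toℕ i) + v₀)                 ≡⟨ +-assoc 1# (ι (toℕ i)) v₀ ⟨
        ι (suc (toℕ i)) + v₀                  ∎

  module GeometricCycle (k : ℕ) {h : Carrier} (h≢0 : h ≢ 0#) (h≢1 : h ≢ 1#)
                        (h^t∈R : ∀ t → InR k (h ^ t)) where
    open Paley F k
    open Cycles k

    order : ∃ λ m → h ^ suc m ≡ 1# × (∀ {j} → j < m → h ^ suc j ≢ 1#)
    order = minimal-witness {P = λ j → h ^ suc j ≡ 1#} (λ j → h ^ suc j Fin.≟ 1#) {ℕ.pred N}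
              (subst (λ n → h ^ n ≡ 1#) (sym (suc-pred N ⦃ ≢-nonZero q-1≢0 ⦄)) (fermat h≢0))

    m : ℕ
    m = proj₁ order

    d : ℕ
    d = suc m

    h^d≡1 : h ^ d ≡ 1#
    h^d≡1 = proj₁ (proj₂ order)

    order-minimal : ∀ {c} → c < d → h ^ c ≡ 1# → c ≡ 0
    order-minimal {zero}  _           _     = refl
    order-minimal {suc c} (ℕ.s≤s c<m) h^c≡1 = contradiction h^c≡1 (proj₂ (proj₂ order) c<m)

    order-∣ : ∀ {n} → h ^ n ≡ 1# → d ∣ n
    order-∣ {n} hⁿ≡1 = m%n≡0⇒n∣m n d (order-minimal (m%n<n n d) (begin
      h ^ r                    ≡⟨ *-identityʳ (h ^ r) ⟨
      h ^ r * 1#               ≡⟨ cong (h ^ r *_) h^[t*d]≡1 ⟨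
      h ^ r * h ^ (t ℕ.* d)    ≡⟨ ^-homo-* h r (t ℕ.* d) ⟨
      h ^ (r ℕ.+ t ℕ.* d)      ≡⟨ cong (h ^_) (m≡m%n+[m/n]*n n d) ⟨
      h ^ n                    ≡⟨ hⁿ≡1 ⟩
      1#                       ∎))
      where
      r t : ℕ
      r = n % d
      t = n / d
      h^[t*d]≡1 : h ^ (t ℕ.* d) ≡ 1#
      h^[t*d]≡1 = begin
        h ^ (t ℕ.* d)   ≡⟨ cong (h ^_) (ℕₚ.*-comm t d) ⟩
        h ^ (d ℕ.* t)   ≡⟨ ^-assocʳ h d t ⟨
        (h ^ d) ^ t     ≡⟨ cong (_^ t) h^d≡1 ⟩
        1# ^ t          ≡⟨ 1^n≡1 t ⟩
        1#              ∎

    G : ℕ → Carrier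
    G zero    = 0#
    G (suc t) = h ^ t + G t

    G-closed-form : ∀ t → (h - 1#) * G t + 1# ≡ h ^ t
    G-closed-form zero    = trans (cong (_+ 1#) (zeroʳ (h - 1#))) (+-identityˡ 1#)
    G-closed-form (suc t) = begin
      w * (h ^ t + G t) + 1#      ≡⟨ cong (_+ 1#) (distribˡ w (h ^ t) (G t)) ⟩
      w * h ^ t + w * G t + 1#    ≡⟨ +-assoc (w * h ^ t) (w * G t) 1# ⟩
      w * h ^ t + (w * G t + 1#)  ≡⟨ cong (w * h ^ t +_) (G-closed-form t) ⟩
      w * h ^ t + h ^ t           ≡⟨ cong (w * h ^ t +_) (*-identityˡ (h ^ t)) ⟨
      w * h ^ t + 1# * h ^ t      ≡⟨ distribʳ (h ^ t) w 1# ⟨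
      (w + 1#) * h ^ t            ≡⟨ cong (_* h ^ t) (//-rightDividesˡ 1# h) ⟩
      h * h ^ t                   ∎
      where
      w : Carrier
      w = h - 1#

    G≡⇒^≡ : ∀ {a b} → G a ≡ G b → h ^ a ≡ h ^ b
    G≡⇒^≡ {a} {b} Gₐ≡Gᵦ = begin
      h ^ a                  ≡⟨ G-closed-form a ⟨
      (h - 1#) * G a + 1#    ≡⟨ cong (λ z → (h - 1#) * z + 1#) Gₐ≡Gᵦ ⟩
      (h - 1#) * G b + 1#    ≡⟨ G-closed-form b ⟩
      h ^ b                  ∎

    G-injective : ∀ {a b} → a < d → b < d → G a ≡ G b → a ≡ b
    G-injective = injective-below G λ {a} {c} c<d Gₐ≡Gₐ₊c →
      order-minimal c<d (sym (*-cancelˡ-≢0 (^-≢0 a h≢0) (begin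
        h ^ a * 1#      ≡⟨ *-identityʳ (h ^ a) ⟩
        h ^ a           ≡⟨ G≡⇒^≡ {a} {a ℕ.+ c} Gₐ≡Gₐ₊c ⟩
        h ^ (a ℕ.+ c)   ≡⟨ ^-homo-* h a c ⟩
        h ^ a * h ^ c   ∎)))

    G[d]≡0 : G d ≡ 0#
    G[d]≡0 = *-cancelˡ-≢0 (h≢1 ∘ x∙y⁻¹≈ε⇒x≈y h 1#) (begin
      (h - 1#) * G d   ≡⟨ +-identityˡ-unique _ 1# (trans (G-closed-form d) h^d≡1) ⟩
      0#               ≡⟨ zeroʳ (h - 1#) ⟨
      (h - 1#) * 0#    ∎)

    geometric-cycle : Cycle m
    geometric-cycle = cycle-of-walk m G (λ t → arc (h^t∈R t)) G[d]≡0 G-injective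

  module Characteristic {p} (p-prime : Prime p) (ι[p]≡0 : ι p ≡ 0#) where

    ∣⇒ι≡0 : ∀ {n} → p ∣ n → ι n ≡ 0#
    ∣⇒ι≡0 (divides c refl) = ι-*-≡0 c ι[p]≡0

    ι≡0⇒∣ : ∀ {n} → ι n ≡ 0# → p ∣ n
    ι≡0⇒∣ {n} ι[n]≡0 with p ∣? n
    ... | yes p∣n = p∣n
    ... | no  p∤n = ⊥-elim (bézout (coprime-Bézout (prime∤⇒coprime p-prime p∤n)))
      where
      bézout : Bézout.Identity 1 p n → ⊥
      bézout (Bézout.+- x y 1+yn≡xp) =
        ι-zeros-not-adjacent (ι-*-≡0 y ι[n]≡0) (ι-*-≡0 x ι[p]≡0) 1+yn≡xp
      bézout (Bézout.-+ x y 1+xp≡yn) =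
        ι-zeros-not-adjacent (ι-*-≡0 x ι[p]≡0) (ι-*-≡0 y ι[n]≡0) 1+xp≡yn

    p∤q-1 : ¬ p ∣ N
    p∤q-1 p∣N = ι-zeros-not-adjacent {N} (∣⇒ι≡0 p∣N) ι[q]≡0 refl

    p′ : ℕ
    p′ = ℕ.pred p

    1+p′≡p : suc p′ ≡ p
    1+p′≡p = suc-pred p ⦃ prime⇒nonZero p-prime ⦄

    ι-cycle : ∀ k → Paley.Cycle F k p′
    ι-cycle k = cycle-of-walk p′ ι (λ _ → arc 1∈R) (subst (λ n → ι n ≡ 0#) (sym 1+p′≡p) ι[p]≡0)
      (injective-below ι λ {a} {c} c<p ιₐ≡ιₐ₊c → ∣∧<⇒≡0
        (ι≡0⇒∣ (+-identityʳ-unique (ι a) (ι c) (sym (trans ιₐ≡ιₐ₊c (ι-homo-+ a c)))))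
        (subst (c <_) 1+p′≡p c<p))
      where open Cycles k

    Γ[q-1]-hasPeriod-p : Paley.HasPeriod F N p
    Γ[q-1]-hasPeriod-p = subst HasPeriod 1+p′≡p (hasPeriod-of-cycle (ι-cycle N) λ n c →
      subst (_∣ suc n) (sym 1+p′≡p) (ι≡0⇒∣ (TranslationGraph.cycle-length-ι≡0 c)))
      where
      open Paley F N
      open Cycles N

    Γ-hasPeriod-1 : ∀ {k} → k ∣ N → k ≢ N → Paley.HasPeriod F k 1
    Γ-hasPeriod-1 {zero}  0∣N _   = ⊥-elim (q-1≢0 (0∣⇒≡0 0∣N))
    Γ-hasPeriod-1 {suc k} k∣N k≢N
      with non-root-of-unity k (≤∧≢⇒< (∣⇒≤ ⦃ ≢-nonZero q-1≢0 ⦄ k∣N) k≢N)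
    ... | x , x≢0 , x^[k+1]≢1 = coprime-cycles⇒hasPeriod-1 (ι-cycle (suc k)) geometric-cycle coprime
      where
      open Cycles (suc k)
      h≢0 : x ^ suc k ≢ 0#
      h≢0 = ^-≢0 (suc k) x≢0
      open GeometricCycle (suc k) h≢0 x^[k+1]≢1 (kth-power-∈R x≢0)
      p∤d : ¬ p ∣ d
      p∤d p∣d = p∤q-1 (∣-trans p∣d (order-∣ (fermat h≢0)))
      coprime : Coprime (suc p′) d
      coprime = subst (λ n → Coprime n d) (sym 1+p′≡p) (prime∤⇒coprime p-prime p∤d)

open import Data.Nat using (_^_)

theorem7p5 : (p m q k : ℕ) → Prime p → ¬ (p ≡ 2) → q ≡ p ^ m → k ∣ q ∸ 1 →
    (F : FiniteField q) → Paley.Directed F k →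
    ((k ≡ q ∸ 1) → Paley.HasPeriod F k p) × (¬ (k ≡ q ∸ 1) → Paley.HasPeriod F k 1)
theorem7p5 p m zero    k _       _ _     _   F _ = ⊥-elim (Fin.¬Fin0 (FiniteField.0# F))
theorem7p5 p m (suc N) k p-prime _ q≡p^m k∣N F _ =
  (λ { refl → Γ[q-1]-hasPeriod-p }) , Γ-hasPeriod-1 k∣N
  where
  open FiniteField F using (0#)
  ι[p]≡0 : ι F p ≡ 0#
  ι[p]≡0 = ι[p^m]≡0⇒ι[p]≡0 F p m (subst (λ n → ι F n ≡ 0#) q≡p^m (ι[q]≡0 F))
  open Characteristic F p-prime ι[p]≡0
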